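{- Let $\mathcal{S}=(a_1,\dots,a_n)$ be an ordered signature of $Q_n$. Then $i\leq a_i$ for all $i\in[n]$.
   Context: $[n]=\{1,\dots,n\}$. $Q_n$: vertices the subsets of $[n]$, edge between $X,Y$ iff $X\oplus Y=\{i\}$ for a single $i$ (the direction). A signature of $Q_n$ is a tuple $(a_1,\dots,a_n)$ where $a_i$ is the number of edges in direction $i$ of some spanning tree of $Q_n$; it is ordered if $a_1\le a_2\le\dots\le a_n$. -}

module Defs where

open import Data.Nat using (ℕ; zero; suc; _≤_)
open import Data.Bool using (Bool; true; false)
open import Data.Fin using (Fin; toℕ)
open import Data.Vec using (Vec; []; _∷_; lookup; _[_]≔_)
open import Data.List using (List; []; _∷_; _++_; [_]; length; map; filterᵇ)
open import Data.List.Relation.Unary.Unique.Propositional using (Unique)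
open import Data.Product using (Σ; _×_; ∃; ∃-syntax)
open import Data.Sum using (_⊎_)
open import Relation.Binary.PropositionalEquality using (_≡_)
open import Relation.Nullary using (¬_)

-- Vertices of Q_n: subsets of [n] = Fin n, as characteristic vectors.
Vertex : ℕ → Set
Vertex n = Vec Bool n

allVertices : (n : ℕ) → List (Vertex n)
allVertices zero = [] ∷ []
allVertices (suc n) = map (false ∷_) (allVertices n) ++ map (true ∷_) (allVertices n)

-- An edge subset of Q_n: every edge of Q_n is uniquely {X, X ∪ {i}} with i ∉ X;
-- E X i = true means this edge (direction i) is selected.
EdgeSet : ℕ → Set
EdgeSet n = Vertex n → Fin n → Bool

WellFormed : ∀ {n} → EdgeSet n → Set
WellFormed {n} E = (X : Vertex n) (i : Fin n) → E X i ≡ true → lookup X i ≡ false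

Adj : ∀ {n} → EdgeSet n → Vertex n → Vertex n → Set
Adj {n} E X Y =
  Σ (Fin n) λ i →
    (E X i ≡ true × Y ≡ X [ i ]≔ true) ⊎ (E Y i ≡ true × X ≡ Y [ i ]≔ true)

data Chain {n} (E : EdgeSet n) : List (Vertex n) → Set where
  single : ∀ x → Chain E (x ∷ [])
  step   : ∀ x y xs → Adj E x y → Chain E (y ∷ xs) → Chain E (x ∷ y ∷ xs)

Connected : ∀ {n} → EdgeSet n → Set
Connected {n} E = (X Y : Vertex n) →
  Σ (List (Vertex n)) λ vs → Chain E (X ∷ vs ++ Y ∷ []) ⊎ (X ≡ Y)

HasCycle : ∀ {n} → EdgeSet n → Set
HasCycle {n} E = Σ (Vertex n) λ v → Σ (List (Vertex n)) λ rest →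
  Unique (v ∷ rest) × 3 ≤ length (v ∷ rest) × Chain E ((v ∷ rest) ++ [ v ])

Acyclic : ∀ {n} → EdgeSet n → Set
Acyclic E = ¬ HasCycle E

IsSpanningTree : ∀ {n} → EdgeSet n → Set
IsSpanningTree E = WellFormed E × Connected E × Acyclic E

edgesInDirection : ∀ {n} → EdgeSet n → Fin n → ℕ
edgesInDirection {n} E i = length (filterᵇ (λ X → E X i) (allVertices n))

-- (a_1,...,a_n) is a signature of Q_n (indices shifted to Fin n = {0..n-1}).
IsSignature : (n : ℕ) → (Fin n → ℕ) → Set
IsSignature n a = Σ (EdgeSet n) λ E → IsSpanningTree E × ((i : Fin n) → a i ≡ edgesInDirection E i)

IsOrdered : ∀ {n} → (Fin n → ℕ) → Set
IsOrdered {n} a = (i j : Fin n) → toℕ i ≤ toℕ j → a i ≤ a j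

-- Contract the edges of a connected spanning subgraph E of Q_n in the directions
-- k+1, …, n. What remains is a connected graph on the 2^k vertices of Q_k whose
-- edges are the edges of E in directions 1, …, k, so there are at least 2^k − 1
-- of them; if the signature is ordered there are at most k·a_k. Hence
-- 2^k ≤ 1 + k·a_k, and since 2^k ≥ 2 + k(k − 1) this forces a_k ≥ k.
-- The contraction is carried out by a union–find relabelling of the vertices,
-- each merge decreasing the number of fixed points of the labelling by at most one.
module Submission where

open import Defs
open import Function using (_∘_)
open import Data.Nat using (ℕ; zero; suc; _+_; _*_; _^_; _≤_; _<_; z≤n; s≤s)
open import Data.Nat.Properties hiding (_≟_)
open import Algebra.Properties.CommutativeSemigroup +-commutativeSemigroup using (interchange)
open import Data.Nat.Tactic.RingSolver using (solve-∀)
open import Data.Bool using (true; false; T; T?)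
open import Data.Unit using (tt)
open import Data.Fin using (Fin; toℕ; inject≤; fromℕ<)
open import Data.Fin.Properties using (toℕ-injective; toℕ<n; toℕ-fromℕ<; toℕ-inject≤)
open import Data.Vec using ([]; _∷_; _[_]≔_; replicate)
open import Data.Vec.Properties using (≡-dec; ∷-injectiveʳ)
open import Data.List using (List; []; _∷_; _++_; length; map; filterᵇ; tabulate)
open import Data.List.Properties using (length-++; length-map; length-tabulate)
open import Data.List.Membership.Propositional using (_∈_)
open import Data.List.Membership.Propositional.Properties
  using (∈-map⁺; ∈-++⁺ˡ; ∈-++⁺ʳ; ∈-filter⁺; ∈-tabulate⁺; ∈-tabulate⁻)
open import Data.List.Relation.Unary.Any using (here; there)
open import Data.Product using (_×_; _,_)
open import Data.Sum using (inj₁; inj₂)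
open import Relation.Nullary using (Dec; yes; no; contradiction)
open import Relation.Binary.PropositionalEquality

private
  variable
    n : ℕ

_≟_ : (x y : Vertex n) → Dec (x ≡ y)
_≟_ = ≡-dec Data.Bool._≟_

cubeSum : ∀ n → (Vertex n → ℕ) → ℕ
cubeSum zero    f = f []
cubeSum (suc n) f = cubeSum n (f ∘ (false ∷_)) + cubeSum n (f ∘ (true ∷_))

cubeSum-cong : ∀ n {f g : Vertex n → ℕ} → (∀ x → f x ≡ g x) → cubeSum n f ≡ cubeSum n g
cubeSum-cong zero    f≗g = f≗g []
cubeSum-cong (suc n) f≗g =
  cong₂ _+_ (cubeSum-cong n (f≗g ∘ (false ∷_))) (cubeSum-cong n (f≗g ∘ (true ∷_)))

cubeSum-mono-≤ : ∀ n {f g : Vertex n → ℕ} → (∀ x → f x ≤ g x) → cubeSum n f ≤ cubeSum n g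
cubeSum-mono-≤ zero    f≤g = f≤g []
cubeSum-mono-≤ (suc n) f≤g =
  +-mono-≤ (cubeSum-mono-≤ n (f≤g ∘ (false ∷_))) (cubeSum-mono-≤ n (f≤g ∘ (true ∷_)))

cubeSum-+ : ∀ n (f g : Vertex n → ℕ) →
            cubeSum n (λ x → f x + g x) ≡ cubeSum n f + cubeSum n g
cubeSum-+ zero    f g = refl
cubeSum-+ (suc n) f g =
  trans (cong₂ _+_ (cubeSum-+ n (f ∘ (false ∷_)) (g ∘ (false ∷_)))
                   (cubeSum-+ n (f ∘ (true ∷_)) (g ∘ (true ∷_))))
        (interchange (cubeSum n (f ∘ (false ∷_))) (cubeSum n (g ∘ (false ∷_))) _ _)

cubeSum-zero : ∀ n {f : Vertex n → ℕ} → (∀ x → f x ≡ 0) → cubeSum n f ≡ 0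
cubeSum-zero zero    f≗0 = f≗0 []
cubeSum-zero (suc n) f≗0 =
  cong₂ _+_ (cubeSum-zero n (f≗0 ∘ (false ∷_))) (cubeSum-zero n (f≗0 ∘ (true ∷_)))

cubeSum-supported : ∀ n (f : Vertex n → ℕ) c → (∀ x → x ≢ c → f x ≡ 0) → cubeSum n f ≡ f c
cubeSum-supported zero    f []          _   = refl
cubeSum-supported (suc n) f (false ∷ c) f≗0 = begin
  cubeSum n (f ∘ (false ∷_)) + cubeSum n (f ∘ (true ∷_))
    ≡⟨ cong₂ _+_ (cubeSum-supported n _ c λ x x≢c → f≗0 _ (x≢c ∘ ∷-injectiveʳ))
                 (cubeSum-zero n λ x → f≗0 _ λ ()) ⟩
  f (false ∷ c) + 0
    ≡⟨ +-identityʳ _ ⟩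
  f (false ∷ c) ∎
  where open ≡-Reasoning
cubeSum-supported (suc n) f (true ∷ c)  f≗0 =
  cong₂ _+_ (cubeSum-zero n λ x → f≗0 _ λ ())
            (cubeSum-supported n _ c λ x x≢c → f≗0 _ (x≢c ∘ ∷-injectiveʳ))

δ : Vertex n → Vertex n → ℕ
δ x y with x ≟ y
... | yes _ = 1
... | no  _ = 0

δ-refl : (x : Vertex n) → δ x x ≡ 1
δ-refl x with x ≟ x
... | yes _  = refl
... | no x≢x = contradiction refl x≢x

δ-≡ : {x y : Vertex n} → x ≡ y → δ x y ≡ 1
δ-≡ {x = x} refl = δ-refl x

δ-≢ : {x y : Vertex n} → x ≢ y → δ x y ≡ 0
δ-≢ {x = x} {y} x≢y with x ≟ y
... | yes x≡y = contradiction x≡y x≢y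
... | no  _   = refl

δ-∷ : ∀ b (x y : Vertex n) → δ (b ∷ x) (b ∷ y) ≡ δ x y
δ-∷ b x y = by-cases (x ≟ y)
  where
  by-cases : Dec (x ≡ y) → δ (b ∷ x) (b ∷ y) ≡ δ x y
  by-cases (yes x≡y) = trans (δ-≡ (cong (b ∷_) x≡y)) (sym (δ-≡ x≡y))
  by-cases (no  x≢y) = trans (δ-≢ (x≢y ∘ ∷-injectiveʳ)) (sym (δ-≢ x≢y))

cubeSum-δ : ∀ n (c : Vertex n) → cubeSum n (λ x → δ x c) ≡ 1
cubeSum-δ n c = trans (cubeSum-supported n _ c λ _ → δ-≢) (δ-refl c)

Labelling : ℕ → Set
Labelling n = Vertex n → Vertex n

fixedPoints : Labelling n → ℕ
fixedPoints {n} L = cubeSum n (λ x → δ (L x) x)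

fixedPoints-const : (L : Labelling n) (c : Vertex n) → (∀ x → L x ≡ c) → fixedPoints L ≡ 1
fixedPoints-const {n} L c L≗c = begin
  cubeSum n (λ x → δ (L x) x)  ≡⟨ cubeSum-supported n _ c vanishes ⟩
  δ (L c) c                    ≡⟨ cong (λ y → δ y c) (L≗c c) ⟩
  δ c c                        ≡⟨ δ-refl c ⟩
  1                            ∎
  where
  open ≡-Reasoning
  vanishes : ∀ x → x ≢ c → δ (L x) x ≡ 0
  vanishes x x≢c = trans (cong (λ y → δ y x) (L≗c x)) (δ-≢ (x≢c ∘ sym))

merge : Vertex n → Vertex n → Labelling n → Labelling n
merge u v L x with L x ≟ L v
... | yes _ = L u
... | no  _ = L x

mergeAll : List (Vertex n × Vertex n) → Labelling n → Labelling n
mergeAll []             L = L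
mergeAll ((u , v) ∷ es) L = mergeAll es (merge u v L)

merge-resp : (u v : Vertex n) (L : Labelling n) {x y : Vertex n} →
             L x ≡ L y → merge u v L x ≡ merge u v L y
merge-resp u v L {x} {y} Lx≡Ly with L x ≟ L v | L y ≟ L v
... | yes _   | yes _   = refl
... | yes x~v | no  y≁v = contradiction (trans (sym Lx≡Ly) x~v) y≁v
... | no  x≁v | yes y~v = contradiction (trans Lx≡Ly y~v) x≁v
... | no  _   | no  _   = Lx≡Ly

mergeAll-resp : ∀ es (L : Labelling n) {x y : Vertex n} →
                L x ≡ L y → mergeAll es L x ≡ mergeAll es L y
mergeAll-resp []             L eq = eq
mergeAll-resp ((u , v) ∷ es) L eq = mergeAll-resp es (merge u v L) (merge-resp u v L eq)

merge-joins : (u v : Vertex n) (L : Labelling n) → merge u v L u ≡ merge u v L v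
merge-joins u v L with L u ≟ L v | L v ≟ L v
... | yes _ | yes _   = refl
... | no  _ | yes _   = refl
... | _     | no  v≁v = contradiction refl v≁v

mergeAll-joins : ∀ es (L : Labelling n) {u v} → (u , v) ∈ es → mergeAll es L u ≡ mergeAll es L v
mergeAll-joins ((u , v) ∷ es) L (here refl) = mergeAll-resp es _ (merge-joins u v L)
mergeAll-joins (_ ∷ es)       L (there e∈es) = mergeAll-joins es _ e∈es

merge-fixed : (u v : Vertex n) (L : Labelling n) (x : Vertex n) →
              δ (L x) x ≤ δ (merge u v L x) x + δ x (L v)
merge-fixed u v L x with L x ≟ x
... | no  _    = z≤n
... | yes Lx≡x with L x ≟ L v
...   | yes x~v = ≤-trans (≤-reflexive (sym (δ-≡ (trans (sym Lx≡x) x~v)))) (m≤n+m _ _)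
...   | no  _   = ≤-trans (≤-reflexive (sym (δ-≡ Lx≡x))) (m≤m+n _ _)

fixedPoints-merge : (u v : Vertex n) (L : Labelling n) → fixedPoints L ≤ fixedPoints (merge u v L) + 1
fixedPoints-merge {n} u v L = begin
  fixedPoints L                                ≤⟨ cubeSum-mono-≤ n (merge-fixed u v L) ⟩
  cubeSum n (λ x → δ (L′ x) x + δ x (L v))     ≡⟨ cubeSum-+ n _ _ ⟩
  fixedPoints L′ + cubeSum n (λ x → δ x (L v)) ≡⟨ cong (fixedPoints L′ +_) (cubeSum-δ n (L v)) ⟩
  fixedPoints L′ + 1                           ∎
  where
  open ≤-Reasoning
  L′ : Labelling n
  L′ = merge u v L

fixedPoints-mergeAll : ∀ es (L : Labelling n) → fixedPoints L ≤ fixedPoints (mergeAll es L) + length es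
fixedPoints-mergeAll []             L = m≤m+n _ _
fixedPoints-mergeAll {n} ((u , v) ∷ es) L = begin
  fixedPoints L                   ≤⟨ fixedPoints-merge u v L ⟩
  fixedPoints L′ + 1              ≤⟨ +-monoˡ-≤ 1 (fixedPoints-mergeAll es L′) ⟩
  fixedPoints M + length es + 1   ≡⟨ +-assoc (fixedPoints M) (length es) 1 ⟩
  fixedPoints M + (length es + 1) ≡⟨ cong (fixedPoints M +_) (+-comm (length es) 1) ⟩
  fixedPoints M + suc (length es) ∎
  where
  open ≤-Reasoning
  L′ M : Labelling n
  L′ = merge u v L
  M  = mergeAll es L′

clearFrom : ℕ → Labelling n
clearFrom zero    x       = replicate _ false
clearFrom (suc k) []      = []
clearFrom (suc k) (b ∷ x) = b ∷ clearFrom k x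

clearFrom-set : ∀ k (x : Vertex n) (j : Fin n) b → k ≤ toℕ j → clearFrom k (x [ j ]≔ b) ≡ clearFrom k x
clearFrom-set zero    x       j           b _         = refl
clearFrom-set (suc k) (c ∷ x) (Fin.suc j) b (s≤s k≤j) = cong (c ∷_) (clearFrom-set k x j b k≤j)

fixedPoints-clearFrom : ∀ {n} k → k ≤ n → fixedPoints {n} (clearFrom k) ≡ 2 ^ k
fixedPoints-clearFrom {n} zero    _ = fixedPoints-const (clearFrom zero) (replicate n false) λ _ → refl
fixedPoints-clearFrom {suc n} (suc k) (s≤s k≤n) = begin
  fixedPoints {suc n} (clearFrom (suc k))
    ≡⟨ cong₂ _+_ (cubeSum-cong n λ x → δ-∷ false (clearFrom k x) x)
                 (cubeSum-cong n λ x → δ-∷ true (clearFrom k x) x) ⟩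
  fixedPoints {n} (clearFrom k) + fixedPoints {n} (clearFrom k)
    ≡⟨ cong (λ m → m + m) (fixedPoints-clearFrom k k≤n) ⟩
  2 ^ k + 2 ^ k
    ≡⟨ cong (2 ^ k +_) (sym (+-identityʳ (2 ^ k))) ⟩
  2 ^ suc k ∎
  where open ≡-Reasoning

module _ {n : ℕ} {E : EdgeSet n} {B : Set} (f : Vertex n → B)
         (adj-resp : ∀ {x y} → Adj E x y → f x ≡ f y) where

  chain-resp : ∀ x xs y → Chain E (x ∷ xs ++ y ∷ []) → f x ≡ f y
  chain-resp x []       y (step _ _ _ x~y _)   = adj-resp x~y
  chain-resp x (z ∷ zs) y (step _ _ _ x~z z⋯y) = trans (adj-resp x~z) (chain-resp z zs y z⋯y)

  connected⇒constant : Connected E → ∀ x y → f x ≡ f y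
  connected⇒constant conn x y with conn x y
  ... | zs , inj₁ x⋯y = chain-resp x zs y x⋯y
  ... | _  , inj₂ refl = refl

∈-allVertices : ∀ n (x : Vertex n) → x ∈ allVertices n
∈-allVertices zero    []          = here refl
∈-allVertices (suc n) (false ∷ x) = ∈-++⁺ˡ (∈-map⁺ (false ∷_) (∈-allVertices n x))
∈-allVertices (suc n) (true ∷ x)  = ∈-++⁺ʳ _ (∈-map⁺ (true ∷_) (∈-allVertices n x))

edgesIn : EdgeSet n → Fin n → List (Vertex n × Vertex n)
edgesIn {n} E j = map (λ x → x , x [ j ]≔ true) (filterᵇ (λ x → E x j) (allVertices n))

length-edgesIn : (E : EdgeSet n) (j : Fin n) → length (edgesIn E j) ≡ edgesInDirection E j
length-edgesIn {n} E j = length-map _ (filterᵇ (λ x → E x j) (allVertices n))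

edgesAlong : EdgeSet n → List (Fin n) → List (Vertex n × Vertex n)
edgesAlong E []       = []
edgesAlong E (j ∷ ds) = edgesIn E j ++ edgesAlong E ds

∈-edgesAlong : (E : EdgeSet n) {ds : List (Fin n)} {j : Fin n} {x : Vertex n} →
               j ∈ ds → E x j ≡ true → (x , x [ j ]≔ true) ∈ edgesAlong E ds
∈-edgesAlong {n} E {j ∷ ds} {x = x} (here refl) Exj≡true =
  ∈-++⁺ˡ (∈-map⁺ _ (∈-filter⁺ (T? ∘ λ y → E y j) (∈-allVertices n x)
                                (subst T (sym Exj≡true) tt)))
∈-edgesAlong E {d ∷ ds} (there j∈ds) Exj≡true = ∈-++⁺ʳ (edgesIn E d) (∈-edgesAlong E j∈ds Exj≡true)

length-edgesAlong-≤ : (E : EdgeSet n) (ds : List (Fin n)) {b : ℕ} →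
                      (∀ {j} → j ∈ ds → edgesInDirection E j ≤ b) →
                      length (edgesAlong E ds) ≤ length ds * b
length-edgesAlong-≤ E []       _           = z≤n
length-edgesAlong-≤ E (j ∷ ds) {b} bounded = begin
  length (edgesIn E j ++ edgesAlong E ds)          ≡⟨ length-++ (edgesIn E j) ⟩
  length (edgesIn E j) + length (edgesAlong E ds)  ≡⟨ cong (_+ _) (length-edgesIn E j) ⟩
  edgesInDirection E j + length (edgesAlong E ds)  ≤⟨ +-mono-≤ (bounded (here refl))
                                                       (length-edgesAlong-≤ E ds (bounded ∘ there)) ⟩
  b + length ds * b                                ∎
  where open ≤-Reasoning

directionsBelow : ∀ {k} → k ≤ n → List (Fin n)
directionsBelow k≤n = tabulate (λ t → inject≤ t k≤n)

length-directionsBelow : ∀ {k} (k≤n : k ≤ n) → length (directionsBelow k≤n) ≡ k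
length-directionsBelow k≤n = length-tabulate (λ t → inject≤ t k≤n)

∈-directionsBelow⁺ : ∀ {k} (k≤n : k ≤ n) {j : Fin n} → toℕ j < k → j ∈ directionsBelow k≤n
∈-directionsBelow⁺ k≤n {j} j<k =
  subst (_∈ directionsBelow k≤n) inject≤-fromℕ< (∈-tabulate⁺ (fromℕ< j<k))
  where
  inject≤-fromℕ< : inject≤ (fromℕ< j<k) k≤n ≡ j
  inject≤-fromℕ< = toℕ-injective (trans (toℕ-inject≤ _ k≤n) (toℕ-fromℕ< j<k))

∈-directionsBelow⁻ : ∀ {k} (k≤n : k ≤ n) {j : Fin n} → j ∈ directionsBelow k≤n → toℕ j < k
∈-directionsBelow⁻ k≤n j∈ds with ∈-tabulate⁻ j∈ds
... | t , refl = subst (_< _) (sym (toℕ-inject≤ t k≤n)) (toℕ<n t)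

-- Edges in directions ≥ k already join vertices with equal labels under clearFrom k,
-- so after merging along the others every edge of E joins equal labels.
connected⇒2^k≤1+|edgesAlong| : (E : EdgeSet n) → Connected E → ∀ {k} (k≤n : k ≤ n) →
                                2 ^ k ≤ 1 + length (edgesAlong E (directionsBelow k≤n))
connected⇒2^k≤1+|edgesAlong| {n} E conn {k} k≤n = begin
  2 ^ k                          ≡⟨ sym (fixedPoints-clearFrom {n} k k≤n) ⟩
  fixedPoints {n} (clearFrom k)  ≤⟨ fixedPoints-mergeAll es (clearFrom k) ⟩
  fixedPoints L + length es      ≡⟨ cong (_+ length es) (fixedPoints-const L (L o) L≗Lo) ⟩
  1 + length es                  ∎
  where
  open ≤-Reasoning
  es : List (Vertex n × Vertex n)
  es = edgesAlong E (directionsBelow k≤n)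
  L : Labelling n
  L = mergeAll es (clearFrom k)
  o : Vertex n
  o = replicate n false

  edge-resp : ∀ x j → E x j ≡ true → L x ≡ L (x [ j ]≔ true)
  edge-resp x j Exj≡true with toℕ j <? k
  ... | yes j<k = mergeAll-joins es _ (∈-edgesAlong E (∈-directionsBelow⁺ k≤n j<k) Exj≡true)
  ... | no  j≮k = mergeAll-resp es _ (sym (clearFrom-set k x j true (≮⇒≥ j≮k)))

  adj-resp : ∀ {x y} → Adj E x y → L x ≡ L y
  adj-resp (j , inj₁ (Exj≡true , refl)) = edge-resp _ j Exj≡true
  adj-resp (j , inj₂ (Eyj≡true , refl)) = sym (edge-resp _ j Eyj≡true)

  L≗Lo : ∀ x → L x ≡ L o
  L≗Lo x = connected⇒constant L adj-resp conn x o

1+m≤2^m : ∀ m → suc m ≤ 2 ^ m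
1+m≤2^m zero    = ≤-refl
1+m≤2^m (suc m) = +-mono-≤ (≤-trans (s≤s z≤n) (1+m≤2^m m)) (≤-trans (1+m≤2^m m) (m≤m+n _ 0))

2+[1+m]*m≤2^[1+m] : ∀ m → 2 + suc m * m ≤ 2 ^ suc m
2+[1+m]*m≤2^[1+m] zero    = ≤-refl
2+[1+m]*m≤2^[1+m] (suc m) = begin
  2 + suc (suc m) * suc m         ≡⟨ expand m ⟩
  (2 + suc m * m) + 2 * suc m     ≤⟨ +-mono-≤ (2+[1+m]*m≤2^[1+m] m) (*-monoʳ-≤ 2 (1+m≤2^m m)) ⟩
  2 ^ suc m + 2 ^ suc m           ≡⟨ cong (2 ^ suc m +_) (sym (+-identityʳ (2 ^ suc m))) ⟩
  2 ^ suc (suc m)                 ∎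
  where
  open ≤-Reasoning
  expand : ∀ m → 2 + suc (suc m) * suc m ≡ (2 + suc m * m) + 2 * suc m
  expand = solve-∀

2^[1+m]≤1+[1+m]*a⇒1+m≤a : ∀ m a → 2 ^ suc m ≤ 1 + suc m * a → suc m ≤ a
2^[1+m]≤1+[1+m]*a⇒1+m≤a m a 2^[1+m]≤ with suc m ≤? a
... | yes 1+m≤a = 1+m≤a
... | no  1+m≰a = contradiction 2^[1+m]≤ (<⇒≱ (begin-strict
  1 + suc m * a    ≤⟨ +-monoʳ-≤ 1 (*-monoʳ-≤ (suc m) (≤-pred (≰⇒> 1+m≰a))) ⟩
  1 + suc m * m    <⟨ n<1+n _ ⟩
  2 + suc m * m    ≤⟨ 2+[1+m]*m≤2^[1+m] m ⟩
  2 ^ suc m        ∎))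
  where open ≤-Reasoning

lemma3p6 : (n : ℕ) (a : Fin n → ℕ) → IsSignature n a → IsOrdered a →
           (i : Fin n) → suc (toℕ i) ≤ a i
lemma3p6 n a (E , (_ , conn , _) , sig) ord i = 2^[1+m]≤1+[1+m]*a⇒1+m≤a (toℕ i) (a i) (begin
  2 ^ k                                              ≤⟨ connected⇒2^k≤1+|edgesAlong| E conn k≤n ⟩
  1 + length (edgesAlong E (directionsBelow k≤n))    ≤⟨ +-monoʳ-≤ 1 (length-edgesAlong-≤ E _ below⇒≤a) ⟩
  1 + length (directionsBelow k≤n) * a i             ≡⟨ cong (λ l → 1 + l * a i) (length-directionsBelow k≤n) ⟩
  1 + k * a i                                        ∎)
  where
  open ≤-Reasoning
  k : ℕ
  k = suc (toℕ i)
  k≤n : k ≤ n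
  k≤n = toℕ<n i

  below⇒≤a : ∀ {j} → j ∈ directionsBelow k≤n → edgesInDirection E j ≤ a i
  below⇒≤a {j} j∈ds = subst (_≤ a i) (sig j) (ord j i (≤-pred (∈-directionsBelow⁻ k≤n j∈ds)))
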